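{- Let $\mathbf{Toff}$ be the free $3$-category described in the context. Rewriting in $\mathbf{Toff}$ terminates: there is no infinite sequence of $2$-cells $f_0, f_1, f_2, \ldots$ of $\mathbf{Toff}$ such that, for every $i \ge 0$, there is a non-identity $3$-cell of $\mathbf{Toff}$ with $2$-source $f_i$ and $2$-target $f_{i+1}$. Equivalently, all reduction sequences of non-identity $3$-cells in $\mathbf{Toff}$ are finite.
   Context: Strict $n$-categories are taken in the globular sense. They have sets of $i$-cells, $i$-sources and $i$-targets ${\tt s}_i,{\tt t}_i$, and compositions $\star_i$ written in diagrammatic order. These satisfy globularity, associativity, local units and the exchange law $(\alpha\star_j\beta)\star_i(\gamma\star_j\delta)=(\alpha\star_i\gamma)\star_j(\beta\star_i\delta)$ for $i<j$. A free $3$-category on a signature consists of all well-formed composites of the generating cells and identities, modulo associativity, unit and exchange. $\mathbf{Toff}$ is the free $3$-category generated as follows. - It has a single $0$-cell $\ast$. - It has a single generating $1$-cell, the wire $\mathtt{w}:\ast\to\ast$. Hence the $1$-cells are the $\star_0$-composites of $n$ wires, $n\in\mathbb{N}$; we denote them by $n$. Then $\star_0$ on $1$-cells is addition, and $0$ is the identity on $\ast$. - Its generating $2$-cells are $\mathtt{SWAP}:2\Rightarrow 2$, $\mathtt{NOT}:1\Rightarrow 1$, $\mathtt{T}_2:2\Rightarrow 2$ and $\mathtt{T}_3:3\Rightarrow 3$. Write $\mathrm{id}_n$ for the identity $2$-cell on $n$. Write $\star_0$ for parallel composition (placing side by side, left to right). Write $\star_1$ for sequential composition: $f\star_1 g$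 means $f$ first, then $g$. Define the following $2$-cells: - $P_3=(\mathtt{SWAP}\star_0\mathrm{id}_1)\star_1(\mathrm{id}_1\star_0\mathtt{SWAP})$; - $Q_3=(\mathrm{id}_1\star_0\mathtt{SWAP})\star_1(\mathtt{SWAP}\star_0\mathrm{id}_1)$; - $P_4=(\mathtt{SWAP}\star_0\mathrm{id}_2)\star_1(\mathrm{id}_1\star_0\mathtt{SWAP}\star_0\mathrm{id}_1)\star_1(\mathrm{id}_2\star_0\mathtt{SWAP})$; - $Q_4=(\mathrm{id}_2\star_0\mathtt{SWAP})\star_1(\mathrm{id}_1\star_0\mathtt{SWAP}\star_0\mathrm{id}_1)\star_1(\mathtt{SWAP}\star_0\mathrm{id}_2)$. The generating $3$-cells (rewriting rules), written source $\Rrightarrow$ target, are: (permutation) - $\mathtt{SWAP}\star_1\mathtt{SWAP}\Rrightarrow\mathrm{id}_2$; - $(\mathtt{SWAP}\star_0\mathrm{id}_1)\star_1(\mathrm{id}_1\star_0\mathtt{SWAP})\star_1(\mathtt{SWAP}\star_0\mathrm{id}_1)\Rrightarrow(\mathrm{id}_1\star_0\mathtt{SWAP})\star_1(\mathtt{SWAP}\star_0\mathrm{id}_1)\star_1(\mathrm{id}_1\star_0\mathtt{SWAP})$. (annihilation) - $\mathtt{NOT}\star_1\mathtt{NOT}\Rrightarrow\mathrm{id}_1$; - $\mathtt{T}_2\star_1\mathtt{T}_2\Rrightarrow\mathrm{id}_2$; - $\mathtt{T}_3\star_1\mathtt{T}_3\Rrightarrow\mathrm{id}_3$. (sliding) -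 $\mathtt{SWAP}\star_1(\mathtt{NOT}\star_0\mathrm{id}_1)\Rrightarrow(\mathrm{id}_1\star_0\mathtt{NOT})\star_1\mathtt{SWAP}$; - $\mathtt{SWAP}\star_1(\mathrm{id}_1\star_0\mathtt{NOT})\Rrightarrow(\mathtt{NOT}\star_0\mathrm{id}_1)\star_1\mathtt{SWAP}$; - $P_3\star_1(\mathtt{T}_2\star_0\mathrm{id}_1)\Rrightarrow(\mathrm{id}_1\star_0\mathtt{T}_2)\star_1P_3$; - $Q_3\star_1(\mathrm{id}_1\star_0\mathtt{T}_2)\Rrightarrow(\mathtt{T}_2\star_0\mathrm{id}_1)\star_1Q_3$; - $P_4\star_1(\mathtt{T}_3\star_0\mathrm{id}_1)\Rrightarrow(\mathrm{id}_1\star_0\mathtt{T}_3)\star_1P_4$; - $Q_4\star_1(\mathrm{id}_1\star_0\mathtt{T}_3)\Rrightarrow(\mathtt{T}_3\star_0\mathrm{id}_1)\star_1Q_4$. (swapped Toffoli) - $(\mathtt{SWAP}\star_0\mathrm{id}_1)\star_1\mathtt{T}_3\Rrightarrow\mathtt{T}_3\star_1(\mathtt{SWAP}\star_0\mathrm{id}_1)$. The $3$-cells of $\mathbf{Toff}$ are all $\star_0,\star_1,\star_2$-composites of these generators and identities, modulo the strict $3$-category axioms. -}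

module Defs where

open import Data.Nat using (ℕ; zero; suc; _+_; _<_)

-- 1-cells of Toff are natural numbers n (the ⋆0-composite of n wires);
-- ⋆0 on 1-cells is addition, 0 is the identity on the unique 0-cell.

data Gen2 : ℕ → ℕ → Set where
  SWAPg : Gen2 2 2
  NOTg  : Gen2 1 1
  T2g   : Gen2 2 2
  T3g   : Gen2 3 3

infixl 6 _⋆₀_
infixl 5 _⋆₁_
data Term2 : ℕ → ℕ → Set where
  gen  : ∀ {n m} → Gen2 n m → Term2 n m
  id₂  : (n : ℕ) → Term2 n n
  _⋆₁_ : ∀ {n m p} → Term2 n m → Term2 m p → Term2 n p
  _⋆₀_ : ∀ {n m n' m'} → Term2 n m → Term2 n' m' → Term2 (n + n') (m + m')

-- It is heterogeneous in the indices only so that the ⋆₀-associativity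
-- and right unit laws typecheck (n + (n' + n'') vs (n + n') + n'', n + 0 vs n);
-- it only ever relates terms with propositionally equal boundaries.
infix 4 _≈₂_
data _≈₂_ : ∀ {n m n' m'} → Term2 n m → Term2 n' m' → Set where
  ≈refl  : ∀ {n m} {f : Term2 n m} → f ≈₂ f
  ≈sym   : ∀ {n m n' m'} {f : Term2 n m} {g : Term2 n' m'} → f ≈₂ g → g ≈₂ f
  ≈trans : ∀ {n m n' m' n'' m''} {f : Term2 n m} {g : Term2 n' m'} {h : Term2 n'' m''} →
           f ≈₂ g → g ≈₂ h → f ≈₂ h
  ⋆₁-cong : ∀ {n m p n' m' p'} {f : Term2 n m} {g : Term2 m p} {f' : Term2 n' m'} {g' : Term2 m' p'} →
            f ≈₂ f' → g ≈₂ g' → (f ⋆₁ g) ≈₂ (f' ⋆₁ g')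
  ⋆₀-cong : ∀ {n m k l n' m' k' l'} {f : Term2 n m} {g : Term2 k l} {f' : Term2 n' m'} {g' : Term2 k' l'} →
            f ≈₂ f' → g ≈₂ g' → (f ⋆₀ g) ≈₂ (f' ⋆₀ g')
  ⋆₁-assoc : ∀ {n m p q} {f : Term2 n m} {g : Term2 m p} {h : Term2 p q} →
             ((f ⋆₁ g) ⋆₁ h) ≈₂ (f ⋆₁ (g ⋆₁ h))
  ⋆₁-idˡ : ∀ {n m} {f : Term2 n m} → (id₂ n ⋆₁ f) ≈₂ f
  ⋆₁-idʳ : ∀ {n m} {f : Term2 n m} → (f ⋆₁ id₂ m) ≈₂ f
  ⋆₀-assoc : ∀ {n m k l p q} {f : Term2 n m} {g : Term2 k l} {h : Term2 p q} →
             ((f ⋆₀ g) ⋆₀ h) ≈₂ (f ⋆₀ (g ⋆₀ h))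
  ⋆₀-idˡ : ∀ {n m} {f : Term2 n m} → (id₂ 0 ⋆₀ f) ≈₂ f
  ⋆₀-idʳ : ∀ {n m} {f : Term2 n m} → (f ⋆₀ id₂ 0) ≈₂ f
  id-⋆₀  : ∀ {n m} → (id₂ n ⋆₀ id₂ m) ≈₂ id₂ (n + m)
  exchange : ∀ {n m p n' m' p'} {f : Term2 n m} {g : Term2 m p} {h : Term2 n' m'} {k : Term2 m' p'} →
             ((f ⋆₁ g) ⋆₀ (h ⋆₁ k)) ≈₂ ((f ⋆₀ h) ⋆₁ (g ⋆₀ k))

SWAP : Term2 2 2
SWAP = gen SWAPg

NOT : Term2 1 1
NOT = gen NOTg

T₂ : Term2 2 2
T₂ = gen T2g

T₃ : Term2 3 3
T₃ = gen T3g

P₃ : Term2 3 3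
P₃ = (SWAP ⋆₀ id₂ 1) ⋆₁ (id₂ 1 ⋆₀ SWAP)

Q₃ : Term2 3 3
Q₃ = (id₂ 1 ⋆₀ SWAP) ⋆₁ (SWAP ⋆₀ id₂ 1)

P₄ : Term2 4 4
P₄ = (SWAP ⋆₀ id₂ 2) ⋆₁ (id₂ 1 ⋆₀ SWAP ⋆₀ id₂ 1) ⋆₁ (id₂ 2 ⋆₀ SWAP)

Q₄ : Term2 4 4
Q₄ = (id₂ 2 ⋆₀ SWAP) ⋆₁ (id₂ 1 ⋆₀ SWAP ⋆₀ id₂ 1) ⋆₁ (SWAP ⋆₀ id₂ 2)

data Gen3 : ∀ {n m} → Term2 n m → Term2 n m → Set where
  swap-swap : Gen3 (SWAP ⋆₁ SWAP) (id₂ 2)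
  yang-baxter : Gen3 ((SWAP ⋆₀ id₂ 1) ⋆₁ (id₂ 1 ⋆₀ SWAP) ⋆₁ (SWAP ⋆₀ id₂ 1))
                     ((id₂ 1 ⋆₀ SWAP) ⋆₁ (SWAP ⋆₀ id₂ 1) ⋆₁ (id₂ 1 ⋆₀ SWAP))
  not-not : Gen3 (NOT ⋆₁ NOT) (id₂ 1)
  t2-t2   : Gen3 (T₂ ⋆₁ T₂) (id₂ 2)
  t3-t3   : Gen3 (T₃ ⋆₁ T₃) (id₂ 3)
  slide-not-l : Gen3 (SWAP ⋆₁ (NOT ⋆₀ id₂ 1)) ((id₂ 1 ⋆₀ NOT) ⋆₁ SWAP)
  slide-not-r : Gen3 (SWAP ⋆₁ (id₂ 1 ⋆₀ NOT)) ((NOT ⋆₀ id₂ 1) ⋆₁ SWAP)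
  slide-t2-P  : Gen3 (P₃ ⋆₁ (T₂ ⋆₀ id₂ 1)) ((id₂ 1 ⋆₀ T₂) ⋆₁ P₃)
  slide-t2-Q  : Gen3 (Q₃ ⋆₁ (id₂ 1 ⋆₀ T₂)) ((T₂ ⋆₀ id₂ 1) ⋆₁ Q₃)
  slide-t3-P  : Gen3 (P₄ ⋆₁ (T₃ ⋆₀ id₂ 1)) ((id₂ 1 ⋆₀ T₃) ⋆₁ P₄)
  slide-t3-Q  : Gen3 (Q₄ ⋆₁ (id₂ 1 ⋆₀ T₃)) ((T₃ ⋆₀ id₂ 1) ⋆₁ Q₄)
  swapped-toffoli : Gen3 ((SWAP ⋆₀ id₂ 1) ⋆₁ T₃) (T₃ ⋆₁ (SWAP ⋆₀ id₂ 1))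

-- Raw 3-cell terms: all ⋆₀, ⋆₁, ⋆₂-composites of generating 3-cells and
-- identities, with 2-source / 2-target given as 2-cell terms. ⋆₂ composes
-- along 2-cells equal in the free 2-category (≈₂).
data Term3 : ∀ {n m} → Term2 n m → Term2 n m → Set where
  gen3 : ∀ {n m} {f g : Term2 n m} → Gen3 f g → Term3 f g
  id₃  : ∀ {n m} (f : Term2 n m) → Term3 f f
  _⊛₀_ : ∀ {n m k l} {f g : Term2 n m} {h j : Term2 k l} →
         Term3 f g → Term3 h j → Term3 (f ⋆₀ h) (g ⋆₀ j)
  _⊛₁_ : ∀ {n m p} {f g : Term2 n m} {h j : Term2 m p} →
         Term3 f g → Term3 h j → Term3 (f ⋆₁ h) (g ⋆₁ j)
  comp₂ : ∀ {n m} {f g g' h : Term2 n m} →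
          Term3 f g → g ≈₂ g' → Term3 g' h → Term3 f h

-- All strict
-- 3-category axioms preserve this number, and a term with no generator
-- is equal to an identity; hence a 3-cell is a non-identity 3-cell of
-- Toff iff (any/every representing term) has at least one generator.
gens : ∀ {n m} {f g : Term2 n m} → Term3 f g → ℕ
gens (gen3 _)     = 1
gens (id₃ _)      = 0
gens (A ⊛₀ B)     = gens A + gens B
gens (A ⊛₁ B)     = gens A + gens B
gens (comp₂ A _ B) = gens A + gens B

NonIdentity : ∀ {n m} {f g : Term2 n m} → Term3 f g → Set
NonIdentity A = 0 < gens A

-- A weighted cost in the spirit of Guiraud's derivations decreases along
-- rewriting. Every wire carries a weight in ℕ; a SWAP adds one to the weights
-- of both wires it crosses, the other gates leave weights unchanged. A gate
-- costs one more than the total weight of the wires it reads (a SWAP reads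
-- only its left wire), and a circuit costs the sum over its gates. This cost
-- is monotone in the input weights and invariant under the strict 2-category
-- axioms. No rule increases output weights, and every rule strictly lowers
-- the cost: sliding moves a gate back across crossings, onto lighter wires.
-- So for the all-zero input weighting, the costs of the 2-cells of a
-- reduction sequence form a strictly decreasing sequence in ℕ.

{-# OPTIONS --safe #-}
module Submission where

open import Defs
open import Data.Nat using (ℕ; zero; suc; _+_; _≤_; _<_; z≤n; s≤s; z<s; s<s; +-rawMagma)
open import Data.Nat.Induction using (<-wellFounded)
open import Data.Nat.Properties
open import Data.Nat.Tactic.RingSolver using (solve-∀)
open import Algebra.Definitions.RawMagma +-rawMagma using (_,_)
open import Algebra.Properties.CommutativeSemigroup +-commutativeSemigroup
  using () renaming (interchange to +-interchange)
open import Data.Product using (Σ; ∃-syntax; _×_; _,_)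
open import Function using (_∘_)
open import Induction.InfiniteDescent
  using (InfiniteDescendingSequence; InfiniteDescendingSequenceFrom; Descent; descent∧wf⇒empty)
open import Induction.WellFounded using (WellFounded)
open import Relation.Binary.Core using (Rel)
open import Relation.Binary.PropositionalEquality
open import Relation.Nullary using (¬_)

wf⇒¬infiniteDescendingSequence : ∀ {a r} {A : Set a} {_≺_ : Rel A r} →
  WellFounded _≺_ → (f : ℕ → A) → ¬ InfiniteDescendingSequence _≺_ f
wf⇒¬infiniteDescendingSequence {_≺_ = _≺_} wf f f↓ =
  descent∧wf⇒empty descent wf (f 0) (f , refl , f↓)
  where
  descent : Descent _≺_ (λ x → ∃[ g ] InfiniteDescendingSequenceFrom _≺_ g x)
  descent (g , refl , g↓) = g 1 , g↓ 0 , g ∘ suc , refl , g↓ ∘ suc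

-- Weights of the wires 0, 1, 2, … from the left. A 2-cell n ⇒ m reads only the
-- first n entries and passes the others through (⟦⟧-local, ⟦⟧-drop). Infinite
-- sequences avoid index casts in the ⋆₀-associativity and right unit laws,
-- whose two sides have boundaries that are only propositionally equal.
Weights : Set
Weights = ℕ → ℕ

infix 4 _≤ʷ_ _≗[_]_

_≤ʷ_ : Weights → Weights → Set
x ≤ʷ y = ∀ i → x i ≤ y i

_≗[_]_ : Weights → ℕ → Weights → Set
x ≗[ n ] y = ∀ i → i < n → x i ≡ y i

drop : ℕ → Weights → Weights
drop n x j = x (n + j)

splice : ℕ → Weights → Weights → Weights
splice zero    x y i       = y i
splice (suc m) x y zero    = x zero
splice (suc m) x y (suc i) = splice m (drop 1 x) y i

drop-+ : ∀ n k (x : Weights) → drop (n + k) x ≗ drop k (drop n x)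
drop-+ n k x = cong x ∘ +-assoc n k

splice-pointwise-< : (R : ℕ → ℕ → Set) → ∀ m {l x x′ y y′} →
  (∀ i → i < m → R (x i) (x′ i)) → (∀ j → j < l → R (y j) (y′ j)) →
  ∀ i → i < m + l → R (splice m x y i) (splice m x′ y′ i)
splice-pointwise-< R zero    Rx Ry i       i<l         = Ry i i<l
splice-pointwise-< R (suc m) Rx Ry zero    _           = Rx zero z<s
splice-pointwise-< R (suc m) Rx Ry (suc i) (s<s i<m+l) =
  splice-pointwise-< R m (λ j → Rx (suc j) ∘ s<s) Ry i i<m+l

splice-pointwise : (R : ℕ → ℕ → Set) → ∀ m {x x′ y y′} →
  (∀ i → i < m → R (x i) (x′ i)) → (∀ j → R (y j) (y′ j)) →
  ∀ i → R (splice m x y i) (splice m x′ y′ i)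
splice-pointwise R m Rx Ry i =
  splice-pointwise-< R m {l = suc i} Rx (λ j _ → Ry j) i (m≤n+m (suc i) m)

splice-agree : ∀ m (x y : Weights) → x ≗[ m ] splice m x y
splice-agree (suc m) x y zero    _         = refl
splice-agree (suc m) x y (suc i) (s<s i<m) = splice-agree m (drop 1 x) y i i<m

drop-splice : ∀ m (x y : Weights) → drop m (splice m x y) ≗ y
drop-splice zero    x y j = refl
drop-splice (suc m) x y j = drop-splice m (drop 1 x) y j

splice-drop : ∀ m (x : Weights) → splice m x (drop m x) ≗ x
splice-drop zero    x i       = refl
splice-drop (suc m) x zero    = refl
splice-drop (suc m) x (suc i) = splice-drop m (drop 1 x) i

splice-assoc : ∀ m l (x y z : Weights) →
  splice (m + l) (splice m x y) z ≗ splice m x (splice l y z)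
splice-assoc zero    l x y z i       = refl
splice-assoc (suc m) l x y z zero    = refl
splice-assoc (suc m) l x y z (suc i) = splice-assoc m l (drop 1 x) y z i

≈₂-boundary : ∀ {n m n′ m′} {f : Term2 n m} {g : Term2 n′ m′} →
  f ≈₂ g → n ≡ n′ × m ≡ m′
≈₂-boundary ≈refl = refl , refl
≈₂-boundary (≈sym p) with ≈₂-boundary p
... | refl , refl = refl , refl
≈₂-boundary (≈trans p q) with ≈₂-boundary p | ≈₂-boundary q
... | refl , refl | refl , refl = refl , refl
≈₂-boundary (⋆₁-cong p q) with ≈₂-boundary p | ≈₂-boundary q
... | refl , _ | _ , refl = refl , refl
≈₂-boundary (⋆₀-cong p q) with ≈₂-boundary p | ≈₂-boundary q
... | refl , refl | refl , refl = refl , refl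
≈₂-boundary ⋆₁-assoc = refl , refl
≈₂-boundary ⋆₁-idˡ = refl , refl
≈₂-boundary ⋆₁-idʳ = refl , refl
≈₂-boundary (⋆₀-assoc {n} {m} {k} {l} {p} {q}) = +-assoc n k p , +-assoc m l q
≈₂-boundary ⋆₀-idˡ = refl , refl
≈₂-boundary (⋆₀-idʳ {n} {m}) = +-identityʳ n , +-identityʳ m
≈₂-boundary id-⋆₀ = refl , refl
≈₂-boundary exchange = refl , refl

module WeightedCost
  (⟦_⟧ᵍ  : ∀ {n m} → Gen2 n m → Weights → Weights)
  (costᵍ : ∀ {n m} → Gen2 n m → Weights → ℕ)
  (⟦⟧ᵍ-mono    : ∀ {n m} (a : Gen2 n m) {x y} → x ≤ʷ y → ⟦ a ⟧ᵍ x ≤ʷ ⟦ a ⟧ᵍ y)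
  (costᵍ-mono  : ∀ {n m} (a : Gen2 n m) {x y} → x ≤ʷ y → costᵍ a x ≤ costᵍ a y)
  (⟦⟧ᵍ-local   : ∀ {n m} (a : Gen2 n m) {x y} → x ≗[ n ] y → ⟦ a ⟧ᵍ x ≗[ m ] ⟦ a ⟧ᵍ y)
  (costᵍ-local : ∀ {n m} (a : Gen2 n m) {x y} → x ≗[ n ] y → costᵍ a x ≡ costᵍ a y)
  (⟦⟧ᵍ-drop    : ∀ {n m} (a : Gen2 n m) x → drop m (⟦ a ⟧ᵍ x) ≗ drop n x)
  where

  ⟦_⟧ : ∀ {n m} → Term2 n m → Weights → Weights
  ⟦ gen a ⟧              = ⟦ a ⟧ᵍ
  ⟦ id₂ n ⟧ x            = x
  ⟦ f ⋆₁ g ⟧ x           = ⟦ g ⟧ (⟦ f ⟧ x)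
  ⟦ _⋆₀_ {n} {m} f g ⟧ x = splice m (⟦ f ⟧ x) (⟦ g ⟧ (drop n x))

  cost : ∀ {n m} → Term2 n m → Weights → ℕ
  cost (gen a)          = costᵍ a
  cost (id₂ n) x        = 0
  cost (f ⋆₁ g) x       = cost f x + cost g (⟦ f ⟧ x)
  cost (_⋆₀_ {n} f g) x = cost f x + cost g (drop n x)

  ⟦⟧-mono : ∀ {n m} (f : Term2 n m) {x y} → x ≤ʷ y → ⟦ f ⟧ x ≤ʷ ⟦ f ⟧ y
  ⟦⟧-mono (gen a)                = ⟦⟧ᵍ-mono a
  ⟦⟧-mono (id₂ n) x≤y            = x≤y
  ⟦⟧-mono (f ⋆₁ g) x≤y           = ⟦⟧-mono g (⟦⟧-mono f x≤y)
  ⟦⟧-mono (_⋆₀_ {n} {m} f g) x≤y =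
    splice-pointwise _≤_ m (λ i _ → ⟦⟧-mono f x≤y i) (⟦⟧-mono g (x≤y ∘ (n +_)))

  cost-mono : ∀ {n m} (f : Term2 n m) {x y} → x ≤ʷ y → cost f x ≤ cost f y
  cost-mono (gen a)            = costᵍ-mono a
  cost-mono (id₂ n) _          = z≤n
  cost-mono (f ⋆₁ g) x≤y       = +-mono-≤ (cost-mono f x≤y) (cost-mono g (⟦⟧-mono f x≤y))
  cost-mono (_⋆₀_ {n} f g) x≤y = +-mono-≤ (cost-mono f x≤y) (cost-mono g (x≤y ∘ (n +_)))

  ⟦⟧-cong : ∀ {n m} (f : Term2 n m) {x y} → x ≗ y → ⟦ f ⟧ x ≗ ⟦ f ⟧ y
  ⟦⟧-cong f x≗y i =
    ≤-antisym (⟦⟧-mono f (≤-reflexive ∘ x≗y) i) (⟦⟧-mono f (≤-reflexive ∘ sym ∘ x≗y) i)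

  cost-cong : ∀ {n m} (f : Term2 n m) {x y} → x ≗ y → cost f x ≡ cost f y
  cost-cong f x≗y =
    ≤-antisym (cost-mono f (≤-reflexive ∘ x≗y)) (cost-mono f (≤-reflexive ∘ sym ∘ x≗y))

  private
    restrictˡ : ∀ n k {x y : Weights} → x ≗[ n + k ] y → x ≗[ n ] y
    restrictˡ n k x≗y i i<n = x≗y i (≤-trans i<n (m≤m+n n k))

    restrictʳ : ∀ n k {x y : Weights} → x ≗[ n + k ] y → drop n x ≗[ k ] drop n y
    restrictʳ n k x≗y j j<k = x≗y (n + j) (+-monoʳ-< n j<k)

  ⟦⟧-local : ∀ {n m} (f : Term2 n m) {x y} → x ≗[ n ] y → ⟦ f ⟧ x ≗[ m ] ⟦ f ⟧ y
  ⟦⟧-local (gen a)      = ⟦⟧ᵍ-local a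
  ⟦⟧-local (id₂ n) x≗y  = x≗y
  ⟦⟧-local (f ⋆₁ g) x≗y = ⟦⟧-local g (⟦⟧-local f x≗y)
  ⟦⟧-local (_⋆₀_ {n} {m} {k} f g) x≗y =
    splice-pointwise-< _≡_ m (⟦⟧-local f (restrictˡ n k x≗y)) (⟦⟧-local g (restrictʳ n k x≗y))

  cost-local : ∀ {n m} (f : Term2 n m) {x y} → x ≗[ n ] y → cost f x ≡ cost f y
  cost-local (gen a)      = costᵍ-local a
  cost-local (id₂ n) _    = refl
  cost-local (f ⋆₁ g) x≗y = cong₂ _+_ (cost-local f x≗y) (cost-local g (⟦⟧-local f x≗y))
  cost-local (_⋆₀_ {n} {n' = k} f g) x≗y =
    cong₂ _+_ (cost-local f (restrictˡ n k x≗y)) (cost-local g (restrictʳ n k x≗y))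

  ⟦⟧-drop : ∀ {n m} (f : Term2 n m) x → drop m (⟦ f ⟧ x) ≗ drop n x
  ⟦⟧-drop (gen a)      = ⟦⟧ᵍ-drop a
  ⟦⟧-drop (id₂ n) x j  = refl
  ⟦⟧-drop (f ⋆₁ g) x j = trans (⟦⟧-drop g (⟦ f ⟧ x) j) (⟦⟧-drop f x j)
  ⟦⟧-drop (_⋆₀_ {n} {m} {k} {l} f g) x j = begin
    splice m (⟦ f ⟧ x) (⟦ g ⟧ (drop n x)) ((m + l) + j) ≡⟨ cong (splice m _ _) (+-assoc m l j) ⟩
    splice m (⟦ f ⟧ x) (⟦ g ⟧ (drop n x)) (m + (l + j)) ≡⟨ drop-splice m _ _ (l + j) ⟩
    ⟦ g ⟧ (drop n x) (l + j)                             ≡⟨ ⟦⟧-drop g (drop n x) j ⟩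
    x (n + (k + j))                                      ≡⟨ drop-+ n k x j ⟨
    x ((n + k) + j)                                      ∎
    where open ≡-Reasoning

  ⟦⟧-resp-≈₂ : ∀ {n m n′ m′} {f : Term2 n m} {g : Term2 n′ m′} →
    f ≈₂ g → ∀ x → ⟦ f ⟧ x ≗ ⟦ g ⟧ x
  ⟦⟧-resp-≈₂ ≈refl x i = refl
  ⟦⟧-resp-≈₂ (≈sym p) x i = sym (⟦⟧-resp-≈₂ p x i)
  ⟦⟧-resp-≈₂ (≈trans p q) x i = trans (⟦⟧-resp-≈₂ p x i) (⟦⟧-resp-≈₂ q x i)
  ⟦⟧-resp-≈₂ (⋆₁-cong {g = g} {f′} p q) x i =
    trans (⟦⟧-cong g (⟦⟧-resp-≈₂ p x) i) (⟦⟧-resp-≈₂ q (⟦ f′ ⟧ x) i)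
  ⟦⟧-resp-≈₂ (⋆₀-cong {n} {m} p q) x with ≈₂-boundary p
  ... | refl , refl =
    splice-pointwise _≡_ m (λ i _ → ⟦⟧-resp-≈₂ p x i) (⟦⟧-resp-≈₂ q (drop n x))
  ⟦⟧-resp-≈₂ ⋆₁-assoc x i = refl
  ⟦⟧-resp-≈₂ ⋆₁-idˡ x i = refl
  ⟦⟧-resp-≈₂ ⋆₁-idʳ x i = refl
  ⟦⟧-resp-≈₂ (⋆₀-assoc {n} {m} {k} {l} {h = h}) x i =
    trans (splice-assoc m l _ _ _ i)
          (splice-pointwise _≡_ m (λ _ _ → refl)
            (splice-pointwise _≡_ l (λ _ _ → refl) (⟦⟧-cong h (drop-+ n k x))) i)
  ⟦⟧-resp-≈₂ ⋆₀-idˡ x i = refl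
  ⟦⟧-resp-≈₂ (⋆₀-idʳ {m = m} {f}) x i =
    trans (splice-pointwise _≡_ m (λ _ _ → refl) (sym ∘ ⟦⟧-drop f x) i)
          (splice-drop m (⟦ f ⟧ x) i)
  ⟦⟧-resp-≈₂ (id-⋆₀ {n}) x = splice-drop n x
  ⟦⟧-resp-≈₂ (exchange {m = m} {p} {f = f} {g} {k = k}) x =
    splice-pointwise _≡_ p (⟦⟧-local g (splice-agree m _ _))
                           (⟦⟧-cong k (sym ∘ drop-splice m (⟦ f ⟧ x) _))

  cost-resp-≈₂ : ∀ {n m n′ m′} {f : Term2 n m} {g : Term2 n′ m′} →
    f ≈₂ g → ∀ x → cost f x ≡ cost g x
  cost-resp-≈₂ ≈refl x = refl
  cost-resp-≈₂ (≈sym p) x = sym (cost-resp-≈₂ p x)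
  cost-resp-≈₂ (≈trans p q) x = trans (cost-resp-≈₂ p x) (cost-resp-≈₂ q x)
  cost-resp-≈₂ (⋆₁-cong {g = g} {f′} p q) x =
    cong₂ _+_ (cost-resp-≈₂ p x)
              (trans (cost-cong g (⟦⟧-resp-≈₂ p x)) (cost-resp-≈₂ q (⟦ f′ ⟧ x)))
  cost-resp-≈₂ (⋆₀-cong {n} p q) x with ≈₂-boundary p
  ... | refl , refl = cong₂ _+_ (cost-resp-≈₂ p x) (cost-resp-≈₂ q (drop n x))
  cost-resp-≈₂ (⋆₁-assoc {f = f}) x = +-assoc (cost f x) _ _
  cost-resp-≈₂ ⋆₁-idˡ x = refl
  cost-resp-≈₂ ⋆₁-idʳ x = +-identityʳ _
  cost-resp-≈₂ (⋆₀-assoc {n} {k = k} {f = f} {g} {h}) x =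
    trans (+-assoc (cost f x) _ _)
          (cong (λ c → cost f x + (cost g (drop n x) + c)) (cost-cong h (drop-+ n k x)))
  cost-resp-≈₂ ⋆₀-idˡ x = refl
  cost-resp-≈₂ ⋆₀-idʳ x = +-identityʳ _
  cost-resp-≈₂ id-⋆₀ x = refl
  cost-resp-≈₂ (exchange {n} {m} {f = f} {g} {h} {k}) x =
    trans (+-interchange (cost f x) _ _ _)
          (cong (cost f x + cost h (drop n x) +_)
                (cong₂ _+_ (cost-local g (splice-agree m _ _))
                           (cost-cong k (sym ∘ drop-splice m (⟦ f ⟧ x) _))))

  module _
    (rule-⟦⟧   : ∀ {n m} {f g : Term2 n m} → Gen3 f g → ∀ x → ⟦ g ⟧ x ≤ʷ ⟦ f ⟧ x)
    (rule-cost : ∀ {n m} {f g : Term2 n m} → Gen3 f g → ∀ x → cost g x < cost f x)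
    where

    ⟦⟧-rewrite : ∀ {n m} {f g : Term2 n m} → Term3 f g → ∀ x → ⟦ g ⟧ x ≤ʷ ⟦ f ⟧ x
    ⟦⟧-rewrite (gen3 r) = rule-⟦⟧ r
    ⟦⟧-rewrite (id₃ f) x i = ≤-refl
    ⟦⟧-rewrite (_⊛₀_ {n} {m} A B) x =
      splice-pointwise _≤_ m (λ i _ → ⟦⟧-rewrite A x i) (⟦⟧-rewrite B (drop n x))
    ⟦⟧-rewrite (_⊛₁_ {f = f} {j = j} A B) x i =
      ≤-trans (⟦⟧-mono j (⟦⟧-rewrite A x) i) (⟦⟧-rewrite B (⟦ f ⟧ x) i)
    ⟦⟧-rewrite (comp₂ A g≈g′ B) x i =
      ≤-trans (⟦⟧-rewrite B x i)
              (≤-trans (≤-reflexive (sym (⟦⟧-resp-≈₂ g≈g′ x i))) (⟦⟧-rewrite A x i))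

    cost-rewrite : ∀ {n m} {f g : Term2 n m} (A : Term3 f g) →
      ∀ x → gens A + cost g x ≤ cost f x
    cost-rewrite (gen3 r) = rule-cost r
    cost-rewrite (id₃ f) x = ≤-refl
    cost-rewrite (_⊛₀_ {n} A B) x =
      ≤-trans (≤-reflexive (+-interchange (gens A) (gens B) _ _))
              (+-mono-≤ (cost-rewrite A x) (cost-rewrite B (drop n x)))
    cost-rewrite (_⊛₁_ {f = f} {g} {h} {j} A B) x = begin
      (gens A + gens B) + (cost g x + cost j (⟦ g ⟧ x))
        ≡⟨ +-interchange (gens A) (gens B) _ _ ⟩
      (gens A + cost g x) + (gens B + cost j (⟦ g ⟧ x))
        ≤⟨ +-monoˡ-≤ _ (cost-rewrite A x) ⟩
      cost f x + (gens B + cost j (⟦ g ⟧ x))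
        ≤⟨ +-monoʳ-≤ (cost f x) (+-monoʳ-≤ (gens B) (cost-mono j (⟦⟧-rewrite A x))) ⟩
      cost f x + (gens B + cost j (⟦ f ⟧ x))
        ≤⟨ +-monoʳ-≤ (cost f x) (cost-rewrite B (⟦ f ⟧ x)) ⟩
      cost f x + cost h (⟦ f ⟧ x)
        ∎
      where open ≤-Reasoning
    cost-rewrite (comp₂ {f = f} {g} {g′} {h} A g≈g′ B) x = begin
      (gens A + gens B) + cost h x ≡⟨ +-assoc (gens A) (gens B) (cost h x) ⟩
      gens A + (gens B + cost h x) ≤⟨ +-monoʳ-≤ (gens A) (cost-rewrite B x) ⟩
      gens A + cost g′ x           ≡⟨ cong (gens A +_) (cost-resp-≈₂ g≈g′ x) ⟨
      gens A + cost g x            ≤⟨ cost-rewrite A x ⟩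
      cost f x                     ∎
      where open ≤-Reasoning

cross : Weights → Weights
cross x 0             = suc (x 1)
cross x 1             = suc (x 0)
cross x (suc (suc i)) = x (suc (suc i))

⟦_⟧ᵗ : ∀ {n m} → Gen2 n m → Weights → Weights
⟦ SWAPg ⟧ᵗ  = cross
⟦ NOTg ⟧ᵗ x = x
⟦ T2g ⟧ᵗ x  = x
⟦ T3g ⟧ᵗ x  = x

costᵗ : ∀ {n m} → Gen2 n m → Weights → ℕ
costᵗ SWAPg x = suc (x 0)
costᵗ NOTg x  = suc (x 0)
costᵗ T2g x   = suc (x 0 + x 1)
costᵗ T3g x   = suc (x 0 + x 1 + x 2)

⟦⟧ᵗ-mono : ∀ {n m} (a : Gen2 n m) {x y} → x ≤ʷ y → ⟦ a ⟧ᵗ x ≤ʷ ⟦ a ⟧ᵗ y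
⟦⟧ᵗ-mono SWAPg x≤y 0             = s≤s (x≤y 1)
⟦⟧ᵗ-mono SWAPg x≤y 1             = s≤s (x≤y 0)
⟦⟧ᵗ-mono SWAPg x≤y (suc (suc i)) = x≤y (suc (suc i))
⟦⟧ᵗ-mono NOTg x≤y = x≤y
⟦⟧ᵗ-mono T2g x≤y  = x≤y
⟦⟧ᵗ-mono T3g x≤y  = x≤y

costᵗ-mono : ∀ {n m} (a : Gen2 n m) {x y} → x ≤ʷ y → costᵗ a x ≤ costᵗ a y
costᵗ-mono SWAPg x≤y = s≤s (x≤y 0)
costᵗ-mono NOTg x≤y  = s≤s (x≤y 0)
costᵗ-mono T2g x≤y   = s≤s (+-mono-≤ (x≤y 0) (x≤y 1))
costᵗ-mono T3g x≤y   = s≤s (+-mono-≤ (+-mono-≤ (x≤y 0) (x≤y 1)) (x≤y 2))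

⟦⟧ᵗ-local : ∀ {n m} (a : Gen2 n m) {x y} → x ≗[ n ] y → ⟦ a ⟧ᵗ x ≗[ m ] ⟦ a ⟧ᵗ y
⟦⟧ᵗ-local SWAPg x≗y 0 _ = cong suc (x≗y 1 (s<s z<s))
⟦⟧ᵗ-local SWAPg x≗y 1 _ = cong suc (x≗y 0 z<s)
⟦⟧ᵗ-local SWAPg x≗y (suc (suc i)) (s<s (s<s ()))
⟦⟧ᵗ-local NOTg x≗y = x≗y
⟦⟧ᵗ-local T2g x≗y  = x≗y
⟦⟧ᵗ-local T3g x≗y  = x≗y

costᵗ-local : ∀ {n m} (a : Gen2 n m) {x y} → x ≗[ n ] y → costᵗ a x ≡ costᵗ a y
costᵗ-local SWAPg x≗y = cong suc (x≗y 0 z<s)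
costᵗ-local NOTg x≗y  = cong suc (x≗y 0 z<s)
costᵗ-local T2g x≗y   = cong suc (cong₂ _+_ (x≗y 0 z<s) (x≗y 1 (s<s z<s)))
costᵗ-local T3g x≗y   =
  cong suc (cong₂ _+_ (cong₂ _+_ (x≗y 0 z<s) (x≗y 1 (s<s z<s))) (x≗y 2 (s<s (s<s z<s))))

⟦⟧ᵗ-drop : ∀ {n m} (a : Gen2 n m) x → drop m (⟦ a ⟧ᵗ x) ≗ drop n x
⟦⟧ᵗ-drop SWAPg x j = refl
⟦⟧ᵗ-drop NOTg x j  = refl
⟦⟧ᵗ-drop T2g x j   = refl
⟦⟧ᵗ-drop T3g x j   = refl

open WeightedCost ⟦_⟧ᵗ costᵗ ⟦⟧ᵗ-mono costᵗ-mono ⟦⟧ᵗ-local costᵗ-local ⟦⟧ᵗ-drop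

rule-⟦⟧ : ∀ {n m} {f g : Term2 n m} → Gen3 f g → ∀ x → ⟦ g ⟧ x ≤ʷ ⟦ f ⟧ x
rule-⟦⟧ swap-swap x = λ { 0 → m≤n+m (x 0) 2 ; 1 → m≤n+m (x 1) 2 ; (suc (suc i)) → ≤-refl }
rule-⟦⟧ yang-baxter x = λ { 0 → ≤-refl ; 1 → ≤-refl ; 2 → ≤-refl ; (suc (suc (suc i))) → ≤-refl }
rule-⟦⟧ not-not x i = ≤-refl
rule-⟦⟧ t2-t2 x i = ≤-refl
rule-⟦⟧ t3-t3 x i = ≤-refl
rule-⟦⟧ slide-not-l x = λ { 0 → ≤-refl ; 1 → ≤-refl ; (suc (suc i)) → ≤-refl }
rule-⟦⟧ slide-not-r x = λ { 0 → ≤-refl ; 1 → ≤-refl ; (suc (suc i)) → ≤-refl }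
rule-⟦⟧ slide-t2-P x = λ { 0 → ≤-refl ; 1 → ≤-refl ; 2 → ≤-refl ; (suc (suc (suc i))) → ≤-refl }
rule-⟦⟧ slide-t2-Q x = λ { 0 → ≤-refl ; 1 → ≤-refl ; 2 → ≤-refl ; (suc (suc (suc i))) → ≤-refl }
rule-⟦⟧ slide-t3-P x =
  λ { 0 → ≤-refl ; 1 → ≤-refl ; 2 → ≤-refl ; 3 → ≤-refl ; (suc (suc (suc (suc i)))) → ≤-refl }
rule-⟦⟧ slide-t3-Q x =
  λ { 0 → ≤-refl ; 1 → ≤-refl ; 2 → ≤-refl ; 3 → ≤-refl ; (suc (suc (suc (suc i)))) → ≤-refl }
rule-⟦⟧ swapped-toffoli x =
  λ { 0 → ≤-refl ; 1 → ≤-refl ; 2 → ≤-refl ; (suc (suc (suc i))) → ≤-refl }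

-- Each `costs` is (1 + target cost) + excess ≡ source cost, both costs written
-- gate by gate for input weights a, b, c, …; a `+ 0` is a parallel identity wire.
rule-cost : ∀ {n m} {f g : Term2 n m} → Gen3 f g → ∀ x → cost g x < cost f x
rule-cost swap-swap x = z<s
rule-cost yang-baxter x = ≤″⇒≤ (0 , costs (x 0) (x 1))
  where
  costs : ∀ a b → suc (suc b + (suc a + 0) + suc (suc a)) + 0
                  ≡ (suc a + 0) + suc (suc a) + (suc (suc b) + 0)
  costs = solve-∀
rule-cost not-not x = z<s
rule-cost t2-t2 x = z<s
rule-cost t3-t3 x = z<s
rule-cost slide-not-l x = ≤″⇒≤ (0 , costs (x 0) (x 1))
  where
  costs : ∀ a b → suc (suc b + suc a) + 0 ≡ suc a + (suc (suc b) + 0)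
  costs = solve-∀
rule-cost slide-not-r x = ≤″⇒≤ (0 , costs (x 0))
  where
  costs : ∀ a → suc ((suc a + 0) + suc a) + 0 ≡ suc a + suc (suc a)
  costs = solve-∀
rule-cost slide-t2-P x = ≤″⇒≤ (1 , costs (x 0) (x 1) (x 2))
  where
  costs : ∀ a b c → suc (suc (b + c) + (suc a + 0 + suc (suc a))) + 1
                    ≡ (suc a + 0 + suc (suc a)) + (suc (suc b + suc c) + 0)
  costs = solve-∀
rule-cost slide-t2-Q x = ≤″⇒≤ (1 , costs (x 0) (x 1))
  where
  costs : ∀ a b → suc ((suc (a + b) + 0) + (suc b + (suc a + 0))) + 1
                  ≡ (suc b + (suc a + 0)) + suc (suc a + suc b)
  costs = solve-∀
rule-cost slide-t3-P x = ≤″⇒≤ (2 , costs (x 0) (x 1) (x 2) (x 3))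
  where
  costs : ∀ a b c d →
    suc (suc (b + c + d) + ((suc a + 0) + (suc (suc a) + 0) + suc (suc (suc a)))) + 2
    ≡ ((suc a + 0) + (suc (suc a) + 0) + suc (suc (suc a))) + (suc (suc b + suc c + suc d) + 0)
  costs = solve-∀
rule-cost slide-t3-Q x = ≤″⇒≤ (2 , costs (x 0) (x 1) (x 2))
  where
  costs : ∀ a b c →
    suc ((suc (a + b + c) + 0) + (suc c + (suc b + 0) + (suc a + 0))) + 2
    ≡ (suc c + (suc b + 0) + (suc a + 0)) + suc (suc a + suc b + suc c)
  costs = solve-∀
rule-cost swapped-toffoli x = ≤″⇒≤ (1 , costs (x 0) (x 1) (x 2))
  where
  costs : ∀ a b c → suc (suc (a + b + c) + (suc a + 0)) + 1
                    ≡ (suc a + 0) + suc (suc b + suc a + c)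
  costs = solve-∀

theorem1 : ∀ {n m} (f : ℕ → Term2 n m) →
           ¬ (∀ i → Σ (Term3 (f i) (f (suc i))) NonIdentity)
theorem1 f steps = wf⇒¬infiniteDescendingSequence <-wellFounded μ μ↓
  where
  zero-weights : Weights
  zero-weights _ = 0

  μ : ℕ → ℕ
  μ i = cost (f i) zero-weights

  μ↓ : InfiniteDescendingSequence _<_ μ
  μ↓ i = let A , A≢id = steps i in
    ≤-trans (+-monoˡ-≤ (μ (suc i)) A≢id) (cost-rewrite rule-⟦⟧ rule-cost A zero-weights)
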